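{- Let $k\in\mathbb{N}=\{0,1,2,\dots\}$. Then for every positive integer $n$, $$\sum_{m=0}^{n-1}(2m+1)^3\binom{m+k}{2k}^2=\frac{(n-k)^2(2n^2-k-1)}{k+1}\binom{n+k}{2k}^2.$$
   Context: Binomial coefficients $\binom{a}{b}$ with integers $0\le a<b$ are $0$. -}

module Defs where

open import Data.Nat using (ℕ; zero; suc)
import Data.Nat as ℕ

sumTo : ℕ → (ℕ → ℕ) → ℕ
sumTo zero    f = 0
sumTo (suc n) f = sumTo n f ℕ.+ f n

module Submission where

-- Write c(n) = C(n+k,2k) and F(n) = (n−k)²(2n²−k−1).  The identity is a
-- telescoping sum: it suffices that (k+1)·Σ_{m<n} ... = F(n)·c(n)² holds in ℤ
-- for every n, which we prove by induction on n.
--   * Binomial coefficients: from Pascal's rule we derive the ratio identity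
--     (r+1)·C(N,r+1) = (N−r)·C(N,r) and the absorption identity
--     (r+1)·C(N+1,r+1) = (N+1)·C(N,r); together they give the "row step"
--     (M−r)·C(M,r) = M·C(M−1,r), which for M = n+k+1, r = 2k reads
--     (n+1−k)·c(n+1) = (n+k+1)·c(n).  All of this is stated over ℕ without
--     truncated subtraction.
--   * Polynomial identity: F(n) + (k+1)(2n+1)³ = (n+k+1)²(2(n+1)²−k−1).
--   * Induction step: F(n)c(n)² + (k+1)(2n+1)³c(n)² = ((n+k+1)c(n))²(2(n+1)²−k−1)
--     = ((n+1−k)c(n+1))²(2(n+1)²−k−1) = F(n+1)c(n+1)².

open import Defs
open import Data.Nat using (ℕ; zero; suc; NonZero; z<s)
import Data.Nat as ℕ
open import Data.Nat.Combinatorics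
  using (_C_; nCk+nC[k+1]≡[n+1]C[k+1]; k>n⇒nCk≡0; nC1≡n)
import Data.Nat.Properties as ℕP
open import Data.Nat.Tactic.RingSolver using (solve-∀)
open import Data.Integer using (ℤ; +_)
import Data.Integer as ℤ
import Data.Integer.Properties as ℤP
open import Data.Integer.Solver using (module +-*-Solver)
open import Data.Rational using (ℚ; _/_; _*_; toℚᵘ)
import Data.Rational.Properties as ℚP
import Data.Rational.Unnormalised as ℚᵘ
import Data.Rational.Unnormalised.Properties as ℚᵘP
open import Relation.Binary.PropositionalEquality
  using (_≡_; refl; sym; trans; cong; cong₂; module ≡-Reasoning)

-- Throughout, ℕ- and ℤ-multiplication is written _·_, since _*_ denotes ℚ-multiplication.
module Binomial where
  open import Data.Nat using (_+_) renaming (_*_ to _·_)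
  open ≡-Reasoning

  binomial-ratio : ∀ N r → suc r · (N C suc r) + r · (N C r) ≡ N · (N C r)
  binomial-ratio zero    zero    = refl
  binomial-ratio zero    (suc s)
    rewrite k>n⇒nCk≡0 {0} {suc (suc s)} z<s | k>n⇒nCk≡0 {0} {suc s} z<s = vanish s
    where
    vanish : ∀ s → suc (suc s) · 0 + suc s · 0 ≡ 0
    vanish = solve-∀
  binomial-ratio (suc N) zero
    rewrite nC1≡n (suc N) = first-entry N
    where
    first-entry : ∀ N → 1 · suc N + 0 · 1 ≡ suc N · 1
    first-entry = solve-∀
  binomial-ratio (suc N) (suc s) = begin
      suc (suc s) · (suc N C suc (suc s)) + suc s · (suc N C suc s)
    ≡⟨ cong₂ (λ x y → suc (suc s) · x + suc s · y)
             (sym (nCk+nC[k+1]≡[n+1]C[k+1] N (suc s)))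
             (sym (nCk+nC[k+1]≡[n+1]C[k+1] N s)) ⟩
      suc (suc s) · (a₁ + a₂) + suc s · (a₀ + a₁)
    ≡⟨ regroup a₀ a₁ a₂ s ⟩
      (suc (suc s) · a₂ + suc s · a₁) + (suc s · a₁ + s · a₀) + (a₁ + a₀)
    ≡⟨ cong₂ (λ x y → x + y + (a₁ + a₀)) (binomial-ratio N (suc s)) (binomial-ratio N s) ⟩
      N · a₁ + N · a₀ + (a₁ + a₀)
    ≡⟨ collect a₀ a₁ N ⟩
      suc N · (a₀ + a₁)
    ≡⟨ cong (suc N ·_) (nCk+nC[k+1]≡[n+1]C[k+1] N s) ⟩
      suc N · (suc N C suc s) ∎
    where
    a₀ a₁ a₂ : ℕ
    a₀ = N C s
    a₁ = N C suc s
    a₂ = N C suc (suc s)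
    regroup : ∀ a₀ a₁ a₂ s → suc (suc s) · (a₁ + a₂) + suc s · (a₀ + a₁)
      ≡ (suc (suc s) · a₂ + suc s · a₁) + (suc s · a₁ + s · a₀) + (a₁ + a₀)
    regroup = solve-∀
    collect : ∀ a₀ a₁ N → N · a₁ + N · a₀ + (a₁ + a₀) ≡ suc N · (a₀ + a₁)
    collect = solve-∀

  absorption : ∀ N r → suc r · (suc N C suc r) ≡ suc N · (N C r)
  absorption N r = begin
      suc r · (suc N C suc r)
    ≡⟨ cong (suc r ·_) (sym (nCk+nC[k+1]≡[n+1]C[k+1] N r)) ⟩
      suc r · (N C r + N C suc r)
    ≡⟨ split (N C r) (N C suc r) r ⟩
      N C r + (suc r · (N C suc r) + r · (N C r))
    ≡⟨ cong (λ x → N C r + x) (binomial-ratio N r) ⟩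
      N C r + N · (N C r)
    ≡⟨⟩
      suc N · (N C r) ∎
    where
    split : ∀ a₀ a₁ r → suc r · (a₀ + a₁) ≡ a₀ + (suc r · a₁ + r · a₀)
    split = solve-∀

  row-step : ∀ N r → suc N · (N C r) + r · (suc N C r) ≡ suc N · (suc N C r)
  row-step N r =
    trans (cong (_+ r · (suc N C r)) (sym (absorption N r))) (binomial-ratio (suc N) r)

open Binomial using (row-step)

module Telescoping where
  open import Data.Integer using (_+_; _-_; _^_) renaming (_*_ to _·_)
  open +-*-Solver using (solve; _:=_; _:+_; _:-_; _:*_; _:^_; con)
  open ≡-Reasoning

  F : ℤ → ℤ → ℤ
  F N K = (N - K) ^ 2 · (+ 2 · N ^ 2 - K - + 1)

  -- The closed form telescopes against the summand (2N+1)³ up to the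
  -- squared ratio (N+K+1)/(N+1−K) of consecutive binomial factors.
  telescope : ∀ N K → F N K + (+ 1 + K) · (+ 2 · N + + 1) ^ 3
    ≡ (+ 1 + (N + K)) ^ 2 · (+ 2 · (+ 1 + N) ^ 2 - K - + 1)
  telescope = solve 2 (λ N K →
      (N :- K) :^ 2 :* (con (+ 2) :* N :^ 2 :- K :- con (+ 1))
        :+ (con (+ 1) :+ K) :* (con (+ 2) :* N :+ con (+ 1)) :^ 3
    := (con (+ 1) :+ (N :+ K)) :^ 2 :* (con (+ 2) :* (con (+ 1) :+ N) :^ 2 :- K :- con (+ 1)))
    refl

  regroup-squares : ∀ a g c → a ^ 2 · g · c ^ 2 ≡ (a · c) ^ 2 · g
  regroup-squares = solve 3 (λ a g c → a :^ 2 :* g :* c :^ 2 := (a :* c) :^ 2 :* g) refl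

  ratio : ∀ N K c₀ c₁ →
    (+ 1 + (N + K)) · c₀ + (+ 2 · K) · c₁ ≡ (+ 1 + (N + K)) · c₁ →
    (+ 1 + N - K) · c₁ ≡ (+ 1 + (N + K)) · c₀
  ratio N K c₀ c₁ row = begin
      (+ 1 + N - K) · c₁
    ≡⟨ solve 3 (λ N K c₁ → (con (+ 1) :+ N :- K) :* c₁
         := (con (+ 1) :+ (N :+ K)) :* c₁ :- (con (+ 2) :* K) :* c₁) refl N K c₁ ⟩
      (+ 1 + (N + K)) · c₁ - (+ 2 · K) · c₁
    ≡⟨ cong (_- (+ 2 · K) · c₁) (sym row) ⟩
      (+ 1 + (N + K)) · c₀ + (+ 2 · K) · c₁ - (+ 2 · K) · c₁
    ≡⟨ solve 2 (λ x y → x :+ y :- y := x) refl ((+ 1 + (N + K)) · c₀) ((+ 2 · K) · c₁) ⟩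
      (+ 1 + (N + K)) · c₀ ∎

  step : ∀ N K S c₀ c₁ →
    (+ 1 + K) · S ≡ F N K · c₀ ^ 2 →
    (+ 1 + (N + K)) · c₀ + (+ 2 · K) · c₁ ≡ (+ 1 + (N + K)) · c₁ →
    (+ 1 + K) · (S + (+ 2 · N + + 1) ^ 3 · c₀ ^ 2) ≡ F (+ 1 + N) K · c₁ ^ 2
  step N K S c₀ c₁ hyp row = begin
      (+ 1 + K) · (S + t · c₀ ^ 2)
    ≡⟨ ℤP.*-distribˡ-+ (+ 1 + K) S (t · c₀ ^ 2) ⟩
      (+ 1 + K) · S + (+ 1 + K) · (t · c₀ ^ 2)
    ≡⟨ cong₂ _+_ hyp (sym (ℤP.*-assoc (+ 1 + K) t (c₀ ^ 2))) ⟩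
      F N K · c₀ ^ 2 + (+ 1 + K) · t · c₀ ^ 2
    ≡⟨ sym (ℤP.*-distribʳ-+ (c₀ ^ 2) (F N K) ((+ 1 + K) · t)) ⟩
      (F N K + (+ 1 + K) · t) · c₀ ^ 2
    ≡⟨ cong (_· c₀ ^ 2) (telescope N K) ⟩
      A ^ 2 · G · c₀ ^ 2
    ≡⟨ regroup-squares A G c₀ ⟩
      (A · c₀) ^ 2 · G
    ≡⟨ cong (λ x → x ^ 2 · G) (sym (ratio N K c₀ c₁ row)) ⟩
      ((+ 1 + N - K) · c₁) ^ 2 · G
    ≡⟨ sym (regroup-squares (+ 1 + N - K) G c₁) ⟩
      F (+ 1 + N) K · c₁ ^ 2 ∎
    where
    t A G : ℤ
    t = (+ 2 · N + + 1) ^ 3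
    A = + 1 + (N + K)
    G = + 2 · (+ 1 + N) ^ 2 - K - + 1

open Telescoping using (F; step)

pos-^ : ∀ a e → + (a ℕ.^ e) ≡ (+ a) ℤ.^ e
pos-^ a zero    = refl
pos-^ a (suc e) = trans (ℤP.pos-* a (a ℕ.^ e)) (cong (+ a ℤ.*_) (pos-^ a e))

-- The closed form vanishes at n = 0: either k = 0 and F(0,0) = 0, or
-- k > 0 and C(k,2k) = 0.
closed-form-at-zero : ∀ k → F (+ 0) (+ k) ℤ.* (+ (k C (2 ℕ.* k))) ℤ.^ 2 ≡ + 0
closed-form-at-zero zero    = refl
closed-form-at-zero (suc j)
  rewrite k>n⇒nCk≡0 {suc j} {2 ℕ.* suc j} (ℕP.m<m+n (suc j) {suc (j ℕ.+ 0)} z<s) =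
  ℤP.*-zeroʳ (F (+ 0) (+ suc j))

module SumIdentity (k : ℕ) where
  open import Data.Integer using (_+_; _^_) renaming (_*_ to _·_)
  open ≡-Reasoning

  c : ℕ → ℕ
  c n = (n ℕ.+ k) C (2 ℕ.* k)

  summand : ℕ → ℕ
  summand m = ((2 ℕ.* m ℕ.+ 1) ℕ.^ 3) ℕ.* c m ℕ.^ 2

  summand-ℤ : ∀ n → + summand n ≡ (+ 2 · + n + + 1) ^ 3 · (+ c n) ^ 2
  summand-ℤ n = begin
      + summand n
    ≡⟨ ℤP.pos-* ((2 ℕ.* n ℕ.+ 1) ℕ.^ 3) (c n ℕ.^ 2) ⟩
      + ((2 ℕ.* n ℕ.+ 1) ℕ.^ 3) · + (c n ℕ.^ 2)
    ≡⟨ cong₂ _·_ (pos-^ (2 ℕ.* n ℕ.+ 1) 3) (pos-^ (c n) 2) ⟩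
      (+ (2 ℕ.* n) + + 1) ^ 3 · (+ c n) ^ 2
    ≡⟨ cong (λ x → (x + + 1) ^ 3 · (+ c n) ^ 2) (ℤP.pos-* 2 n) ⟩
      (+ 2 · + n + + 1) ^ 3 · (+ c n) ^ 2 ∎

  row-ℤ : ∀ n → (+ 1 + (+ n + + k)) · + c n + (+ 2 · + k) · + c (suc n)
              ≡ (+ 1 + (+ n + + k)) · + c (suc n)
  row-ℤ n = begin
      + M · + c n + (+ 2 · + k) · + c (suc n)
    ≡⟨ cong (λ x → + M · + c n + x · + c (suc n)) (sym (ℤP.pos-* 2 k)) ⟩
      + M · + c n + + (2 ℕ.* k) · + c (suc n)
    ≡⟨ cong₂ _+_ (sym (ℤP.pos-* M (c n))) (sym (ℤP.pos-* (2 ℕ.* k) (c (suc n)))) ⟩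
      + (M ℕ.* c n ℕ.+ 2 ℕ.* k ℕ.* c (suc n))
    ≡⟨ cong +_ (row-step (n ℕ.+ k) (2 ℕ.* k)) ⟩
      + (M ℕ.* c (suc n))
    ≡⟨ ℤP.pos-* M (c (suc n)) ⟩
      + M · + c (suc n) ∎
    where
    M : ℕ
    M = suc (n ℕ.+ k)

  sum-identity : ∀ n → + suc k · + sumTo n summand ≡ F (+ n) (+ k) · (+ c n) ^ 2
  sum-identity zero    = trans (ℤP.*-zeroʳ (+ suc k)) (sym (closed-form-at-zero k))
  sum-identity (suc n) = begin
      + suc k · (+ sumTo n summand + + summand n)
    ≡⟨ cong (λ x → + suc k · (+ sumTo n summand + x)) (summand-ℤ n) ⟩
      + suc k · (+ sumTo n summand + (+ 2 · + n + + 1) ^ 3 · (+ c n) ^ 2)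
    ≡⟨ step (+ n) (+ k) (+ sumTo n summand) (+ c n) (+ c (suc n))
            (sum-identity n) (row-ℤ n) ⟩
      F (+ suc n) (+ k) · (+ c (suc n)) ^ 2 ∎

open SumIdentity using (summand; sum-identity)

cross-multiply : ∀ (S P D : ℤ) d → + suc d ℤ.* S ≡ P ℤ.* D → S / 1 ≡ (P / suc d) * (D / 1)
cross-multiply S P D d eq = ℚP.toℚᵘ-injective (begin
    toℚᵘ (S / 1)                           ≈⟨ ℚP.toℚᵘ-fromℚᵘ (S ℚᵘ./ 1) ⟩
    S ℚᵘ./ 1                               ≈⟨ ℚᵘ.*≡* cross ⟩
    (P ℚᵘ./ suc d) ℚᵘ.* (D ℚᵘ./ 1)         ≈⟨ ℚᵘP.*-cong (ℚP.toℚᵘ-fromℚᵘ (P ℚᵘ./ suc d))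
                                                         (ℚP.toℚᵘ-fromℚᵘ (D ℚᵘ./ 1)) ⟨
    toℚᵘ (P / suc d) ℚᵘ.* toℚᵘ (D / 1)     ≈⟨ ℚP.toℚᵘ-homo-* (P / suc d) (D / 1) ⟨
    toℚᵘ ((P / suc d) * (D / 1))           ∎)
  where
  open ℚᵘP.≃-Reasoning
  cross : S ℤ.* (+ suc d ℤ.* + 1) ≡ (P ℤ.* D) ℤ.* + 1
  cross = trans (cong (S ℤ.*_) (ℤP.*-identityʳ (+ suc d)))
         (trans (ℤP.*-comm S (+ suc d))
         (trans eq (sym (ℤP.*-identityʳ (P ℤ.* D)))))

lemma3p4 : (k n : ℕ) → .{{_ : NonZero n}} →
    (+ sumTo n (λ m → ((2 ℕ.* m ℕ.+ 1) ℕ.^ 3) ℕ.* ((m ℕ.+ k) C (2 ℕ.* k)) ℕ.^ 2)) / 1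
    ≡ (((+ n ℤ.- + k) ℤ.^ 2) ℤ.* ((+ 2) ℤ.* (+ n) ℤ.^ 2 ℤ.- + k ℤ.- + 1)) / suc k
    * ((+ (((n ℕ.+ k) C (2 ℕ.* k)) ℕ.^ 2)) / 1)
lemma3p4 k n = cross-multiply (+ sumTo n (summand k)) (F (+ n) (+ k)) (+ (c ℕ.^ 2)) k
  (trans (sum-identity k n) (cong (F (+ n) (+ k) ℤ.*_) (sym (pos-^ c 2))))
  where
  c : ℕ
  c = (n ℕ.+ k) C (2 ℕ.* k)
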